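{- Let $\mathfrak g\in\{A_2,C_2,G_2\}$, let $a,b\ge0$ be integers and $\lambda=(a,b)$. Then the set $\mathcal S_{\mathfrak g}(\lambda)$ of $\mathfrak g$-semistandard tableaux of shape $\lambda$ is as follows (where $(i,j)$ denotes a length-two column with top entry $i$ and bottom entry $j$, and $(i)$ a length-one column): $\mathcal S_{A_2}(\lambda)$ is the set of all semistandard tableaux of shape $\lambda$ with entries from $\{1,2,3\}$. $\mathcal S_{C_2}(\lambda)$ is the set of semistandard tableaux $T$ of shape $\lambda$ with entries from $\{1,2,3,4\}$ such that $(1,4)$ is not a column of $T$ and $(2,3)$ appears at most once as a column of $T$. $\mathcal S_{G_2}(\lambda)$ is the set of semistandard tableaux $T$ of shape $\lambda$ with entries from $\{1,\dots,7\}$ such that: the column $(4)$ appears at most once in $T$; none of $(2,3),(2,4),(3,4),(3,5),(4,5),(4,6),(5,6)$ is a column of $T$; and for consecutive columns $T^{(i)},T^{(i+1)}$: if $T^{(i)}=(4)$ then $T^{(i+1)}\ne(4)$; if $T^{(i)}=(1,4)$ then $T^{(i+1)}\notin\{(1),(1,4),(1,5),(1,6),(1,7)\}$; if $T^{(i)}=(1,5)$ then $T^{(i+1)}\notin\{(1),(1,5),(1,6),(1,7)\}$; if $T^{(i)}=(1,6)$ then $T^{(i+1)}\notin\{(1),(2),(1,6),(1,7),(2,6),(2,7)\}$; if $T^{(i)}=(2,6)$ then $T^{(i+1)}\notin\{(2),(2,6),(2,7)\}$; if $T^{(i)}=(1,7)$ then $T^{(i+1)}\notin\{(1),(2),(3),(4),(1,7),(2,7),(3,7),(4,7)\}$;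 if $T^{(i)}=(2,7)$ then $T^{(i+1)}\notin\{(2),(3),(4),(2,7),(3,7),(4,7)\}$; if $T^{(i)}=(3,7)$ then $T^{(i+1)}\notin\{(3),(4),(3,7),(4,7)\}$; if $T^{(i)}=(4,7)$ then $T^{(i+1)}\notin\{(4),(4,7)\}$.
   Context: Shape $\lambda=(a,b)$: the Ferrers diagram with $b$ columns of length two followed (to the right) by $a$ columns of length one; a tableau $T=(T^{(1)},\dots,T^{(a+b)})$ fills it ($T^{(i)}$ the $i$-th column from the left). $T$ is semistandard if entries weakly increase along rows and strictly increase down columns. Fundamental posets ($u\lessdot v$ means $v$ covers $u$; data (color, chain index)): $A_2$: $F(1,0)$: $z_2\lessdot z_1$, $z_2:(\beta,2)$, $z_1:(\alpha,1)$; $F(0,1)$: $w_2\lessdot w_1$, $w_2:(\alpha,2)$, $w_1:(\beta,1)$. $C_2$: $F(1,0)$: $z_3\lessdot z_2\lessdot z_1$, $z_3:(\alpha,3)$, $z_2:(\beta,2)$, $z_1:(\alpha,1)$; $F(0,1)$: $w_4\lessdot w_3\lessdot w_2\lessdot w_1$, $w_4:(\beta,3)$, $w_3:(\alpha,2)$, $w_2:(\alpha,2)$, $w_1:(\beta,1)$. $G_2$: $F(1,0)$: $z_6\lessdot\cdots\lessdot z_1$, $z_6:(\alpha,5)$, $z_5:(\beta,4)$, $z_4:(\alpha,3)$, $z_3:(\alpha,3)$, $z_2:(\beta,2)$, $z_1:(\alpha,1)$; $F(0,1)$: $a_1,\dots,a_{10}$ with covers $a_1\lessdot a_2\lessdot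 a_3$, $a_3\lessdot a_4$, $a_3\lessdot a_6$, $a_4\lessdot a_5$, $a_4\lessdot a_7$, $a_6\lessdot a_7$, $a_5\lessdot a_8$, $a_7\lessdot a_8$, $a_8\lessdot a_9\lessdot a_{10}$, and $a_1:(\beta,5)$; $a_2,a_3,a_6:(\alpha,4)$; $a_4,a_7:(\beta,3)$; $a_5,a_8,a_9:(\alpha,2)$; $a_{10}:(\beta,1)$. $P^{\beta\alpha}_{\mathfrak g}(a,b)$: disjoint copies $Q_1,\dots,Q_b$ of $F(0,1)$ followed by $Q_{b+1},\dots,Q_{a+b}$ of $F(1,0)$; chain index as in the fundamental poset for copies of $F(0,1)$ and plus $1$ for copies of $F(1,0)$; order = smallest partial order containing each $Q_i$'s order and $x<y$ whenever $x\in Q_i$, $y\in Q_j$, $i<j$, with equal chain index. Columns of fundamental order ideals. Let $N=3,4,7$ for $A_2,C_2,G_2$. $F(1,0)$ is a chain; its order ideal with $k$ elements gets the column $(N-k)$. Order ideals of $F(0,1)$: $A_2$: $\emptyset\mapsto(2,3)$, $\{w_2\}\mapsto(1,3)$, $\{w_2,w_1\}\mapsto(1,2)$. $C_2$: the ideals of sizes $0,1,2,3,4$ map to $(3,4),(2,4),(2,3),(1,3),(1,2)$. $G_2$: $\emptyset\mapsto(6,7)$, $\{a_1\}\mapsto(5,7)$, $\{a_1,a_2\}\mapsto(4,7)$, $\{a_1,a_2,a_3\}\mapsto(3,7)$, $\{a_1,a_2,a_3,a_4\}\mapsto(2,7)$, $\{a_1,a_2,a_3,a_6\}\mapsto(3,6)$,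 $\{a_1,a_2,a_3,a_4,a_6\}\mapsto(2,6)$, $\{a_1,\dots,a_5\}\mapsto(1,7)$, $\{a_1,\dots,a_6\}\mapsto(1,6)$, $\{a_1,a_2,a_3,a_4,a_6,a_7\}\mapsto(2,5)$, $\{a_1,\dots,a_7\}\mapsto(1,5)$, $\{a_1,\dots,a_8\}\mapsto(1,4)$, $\{a_1,\dots,a_9\}\mapsto(1,3)$, $\{a_1,\dots,a_{10}\}\mapsto(1,2)$. For an order ideal $t$ of $P^{\beta\alpha}_{\mathfrak g}(a,b)$, $\mathbf{tableau}(t)$ is the tableau of shape $\lambda$ whose $i$-th column is the column assigned to $t\cap Q_i$ (viewed as an order ideal of the fundamental poset $Q_i$ is a copy of). $\mathcal S_{\mathfrak g}(\lambda)$ is the set of all $\mathbf{tableau}(t)$. -}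

module Defs where

open import Data.Nat using (ℕ; zero; suc; _+_; _∸_; _≤_; _<_)
open import Data.Fin using (Fin; toℕ; splitAt)
import Data.Fin as F
open import Data.Vec using (Vec; []; _∷_; lookup; tabulate)
open import Data.List using (List; [])
import Data.List as L
open import Data.List.Membership.Propositional using (_∉_)
open import Data.Bool using (Bool; true; false; if_then_else_)
open import Data.Maybe using (Maybe; just; nothing)
open import Data.Product using (Σ; _×_; _,_; proj₁; proj₂)
open import Data.Sum using (_⊎_; inj₁; inj₂; [_,_])
open import Relation.Binary.PropositionalEquality using (_≡_; _≢_)
open import Relation.Binary.Construct.Closure.ReflexiveTransitive using (Star)

data Lie : Set where
  A2 C2 G2 : Lie

bigN : Lie → ℕ
bigN A2 = 3
bigN C2 = 4
bigN G2 = 7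

-- number of elements of F(1,0) and of F(0,1)
s10 : Lie → ℕ
s10 A2 = 2
s10 C2 = 3
s10 G2 = 6

s01 : Lie → ℕ
s01 A2 = 2
s01 C2 = 4
s01 G2 = 10

-- F(1,0): index m : Fin (s10 g) stands for z_{m+1}.
-- F(0,1): index m stands for w_{m+1} (A2, C2) resp. a_{m+1} (G2).
-- Cov g x y  means  x ⋖ y  (y covers x).  Colours play no role in the order.

-- F(1,0) is the chain z_k ⋖ ... ⋖ z_1 :  z_{m+2} ⋖ z_{m+1}
Cov10 : (g : Lie) → Fin (s10 g) → Fin (s10 g) → Set
Cov10 g x y = toℕ x ≡ suc (toℕ y)

-- covers of the G2 poset F(0,1) on indices 0..9 (a_{m+1})
data CovG2 : ℕ → ℕ → Set where
  c1-2 : CovG2 0 1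
  c2-3 : CovG2 1 2
  c3-4 : CovG2 2 3
  c3-6 : CovG2 2 5
  c4-5 : CovG2 3 4
  c4-7 : CovG2 3 6
  c6-7 : CovG2 5 6
  c5-8 : CovG2 4 7
  c7-8 : CovG2 6 7
  c8-9 : CovG2 7 8
  c9-10 : CovG2 8 9

Cov01 : (g : Lie) → Fin (s01 g) → Fin (s01 g) → Set
Cov01 A2 x y = toℕ x ≡ suc (toℕ y)
Cov01 C2 x y = toℕ x ≡ suc (toℕ y)
Cov01 G2 x y = CovG2 (toℕ x) (toℕ y)

-- chain indices in the fundamental posets
ci10 : (g : Lie) → Fin (s10 g) → ℕ
ci10 A2 x = lookup (1 ∷ 2 ∷ []) x
ci10 C2 x = lookup (1 ∷ 2 ∷ 3 ∷ []) x
ci10 G2 x = lookup (1 ∷ 2 ∷ 3 ∷ 3 ∷ 4 ∷ 5 ∷ []) x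

ci01 : (g : Lie) → Fin (s01 g) → ℕ
ci01 A2 x = lookup (1 ∷ 2 ∷ []) x
ci01 C2 x = lookup (1 ∷ 2 ∷ 2 ∷ 3 ∷ []) x
ci01 G2 x = lookup (5 ∷ 4 ∷ 4 ∷ 3 ∷ 2 ∷ 4 ∷ 3 ∷ 2 ∷ 2 ∷ 1 ∷ []) x

-- Copies Q_1..Q_b of F(0,1) are  inj₁ (i , x)  with i : Fin b,
-- copies Q_{b+1}..Q_{b+a} of F(1,0) are  inj₂ (j , x)  with j : Fin a
-- (copy number b+1+j).  In P, chain indices of F(1,0)-copies are shifted by 1.

Elem : Lie → ℕ → ℕ → Set
Elem g a b = (Fin b × Fin (s01 g)) ⊎ (Fin a × Fin (s10 g))

chainP : ∀ {g a b} → Elem g a b → ℕ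
chainP {g} (inj₁ (_ , x)) = ci01 g x
chainP {g} (inj₂ (_ , x)) = suc (ci10 g x)

-- generating relations (x < y) of the order on P
data Gen (g : Lie) (a b : ℕ) : Elem g a b → Elem g a b → Set where
  in01  : ∀ {i x y} → Cov01 g x y → Gen g a b (inj₁ (i , x)) (inj₁ (i , y))
  in10  : ∀ {j x y} → Cov10 g x y → Gen g a b (inj₂ (j , x)) (inj₂ (j , y))
  x0101 : ∀ {i i' x y} → toℕ i < toℕ i' →
          chainP {g} {a} {b} (inj₁ (i , x)) ≡ chainP {g} {a} {b} (inj₁ (i' , y)) →
          Gen g a b (inj₁ (i , x)) (inj₁ (i' , y))
  x1010 : ∀ {j j' x y} → toℕ j < toℕ j' →
          chainP {g} {a} {b} (inj₂ (j , x)) ≡ chainP {g} {a} {b} (inj₂ (j' , y)) →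
          Gen g a b (inj₂ (j , x)) (inj₂ (j' , y))
  x0110 : ∀ {i j x y} →
          chainP {g} {a} {b} (inj₁ (i , x)) ≡ chainP {g} {a} {b} (inj₂ (j , y)) →
          Gen g a b (inj₁ (i , x)) (inj₂ (j , y))

_≤P_ : ∀ {g a b} → Elem g a b → Elem g a b → Set
_≤P_ {g} {a} {b} = Star (Gen g a b)

IsIdeal : ∀ {g a b} → (Elem g a b → Bool) → Set
IsIdeal {g} {a} {b} t = ∀ (x y : Elem g a b) → x ≤P y → t y ≡ true → t x ≡ true

countT : ∀ n → (Fin n → Bool) → ℕ
countT zero f = 0
countT (suc n) f = (if f F.zero then 1 else 0) + countT n (λ k → f (F.suc k))

col10 : (g : Lie) → (Fin (s10 g) → Bool) → ℕ
col10 g s = bigN g ∸ countT (s10 g) s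

colA2 : ℕ → Maybe (ℕ × ℕ)
colA2 0 = just (2 , 3)
colA2 1 = just (1 , 3)
colA2 2 = just (1 , 2)
colA2 _ = nothing

colC2 : ℕ → Maybe (ℕ × ℕ)
colC2 0 = just (3 , 4)
colC2 1 = just (2 , 4)
colC2 2 = just (2 , 3)
colC2 3 = just (1 , 3)
colC2 4 = just (1 , 2)
colC2 _ = nothing

-- membership vector (a_1 , ... , a_10)
colG2 : Vec Bool 10 → Maybe (ℕ × ℕ)
colG2 (false ∷ false ∷ false ∷ false ∷ false ∷ false ∷ false ∷ false ∷ false ∷ false ∷ []) = just (6 , 7)
colG2 (true ∷ false ∷ false ∷ false ∷ false ∷ false ∷ false ∷ false ∷ false ∷ false ∷ []) = just (5 , 7)
colG2 (true ∷ true ∷ false ∷ false ∷ false ∷ false ∷ false ∷ false ∷ false ∷ false ∷ []) = just (4 , 7)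
colG2 (true ∷ true ∷ true ∷ false ∷ false ∷ false ∷ false ∷ false ∷ false ∷ false ∷ []) = just (3 , 7)
colG2 (true ∷ true ∷ true ∷ true ∷ false ∷ false ∷ false ∷ false ∷ false ∷ false ∷ []) = just (2 , 7)
colG2 (true ∷ true ∷ true ∷ false ∷ false ∷ true ∷ false ∷ false ∷ false ∷ false ∷ []) = just (3 , 6)
colG2 (true ∷ true ∷ true ∷ true ∷ false ∷ true ∷ false ∷ false ∷ false ∷ false ∷ []) = just (2 , 6)
colG2 (true ∷ true ∷ true ∷ true ∷ true ∷ false ∷ false ∷ false ∷ false ∷ false ∷ []) = just (1 , 7)
colG2 (true ∷ true ∷ true ∷ true ∷ true ∷ true ∷ false ∷ false ∷ false ∷ false ∷ []) = just (1 , 6)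
colG2 (true ∷ true ∷ true ∷ true ∷ false ∷ true ∷ true ∷ false ∷ false ∷ false ∷ []) = just (2 , 5)
colG2 (true ∷ true ∷ true ∷ true ∷ true ∷ true ∷ true ∷ false ∷ false ∷ false ∷ []) = just (1 , 5)
colG2 (true ∷ true ∷ true ∷ true ∷ true ∷ true ∷ true ∷ true ∷ false ∷ false ∷ []) = just (1 , 4)
colG2 (true ∷ true ∷ true ∷ true ∷ true ∷ true ∷ true ∷ true ∷ true ∷ false ∷ []) = just (1 , 3)
colG2 (true ∷ true ∷ true ∷ true ∷ true ∷ true ∷ true ∷ true ∷ true ∷ true ∷ []) = just (1 , 2)
colG2 _ = nothing

-- F(0,1): column of an order ideal (nothing on non-ideals, which never occur)
col01 : (g : Lie) → (Fin (s01 g) → Bool) → Maybe (ℕ × ℕ)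
col01 A2 s = colA2 (countT 2 s)
col01 C2 s = colC2 (countT 4 s)
col01 G2 s = colG2 (tabulate s)

-- Tableaux of shape λ = (a,b): b columns of length two, then a of length one.

record Tableau (a b : ℕ) : Set where
  field
    dbl : Fin b → ℕ × ℕ   -- (top , bottom) of the length-two columns T^(1..b)
    sgl : Fin a → ℕ       -- entries of the length-one columns T^(b+1..b+a)
open Tableau public

data Col : Set where
  two : ℕ → ℕ → Col
  one : ℕ → Col

-- the k-th column T^(k+1)
column : ∀ {a b} → Tableau a b → Fin (b + a) → Col
column {a} {b} T k = [ (λ i → two (proj₁ (dbl T i)) (proj₂ (dbl T i))) , (λ j → one (sgl T j)) ] (splitAt b k)

topEntry : Col → ℕ
topEntry (two i _) = i
topEntry (one i) = i

InRange : ℕ → Col → Set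
InRange n (two i j) = (1 ≤ i × i ≤ n) × (1 ≤ j × j ≤ n)
InRange n (one i) = 1 ≤ i × i ≤ n

Semistandard : ∀ {a b} → ℕ → Tableau a b → Set
Semistandard {a} {b} n T =
  (∀ k → InRange n (column T k)) ×
  (∀ i → proj₁ (dbl T i) < proj₂ (dbl T i)) ×
  (∀ (k k' : Fin (b + a)) → toℕ k ≤ toℕ k' → topEntry (column T k) ≤ topEntry (column T k')) ×
  (∀ (i i' : Fin b) → toℕ i ≤ toℕ i' → proj₂ (dbl T i) ≤ proj₂ (dbl T i'))

AtMostOnce : ∀ {a b} → Tableau a b → Col → Set
AtMostOnce {a} {b} T c = ∀ (k k' : Fin (b + a)) → column T k ≡ c → column T k' ≡ c → k ≡ k'

Consec : ∀ {a b} → Tableau a b → (Col → Col → Set) → Set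
Consec {a} {b} T R = ∀ (k k' : Fin (b + a)) → toℕ k' ≡ suc (toℕ k) → R (column T k) (column T k')

forbiddenG2 : List Col
forbiddenG2 = two 2 3 L.∷ two 2 4 L.∷ two 3 4 L.∷ two 3 5 L.∷ two 4 5 L.∷ two 4 6 L.∷ two 5 6 L.∷ []

afterG2 : Col → List Col
afterG2 (one 4) = one 4 L.∷ []
afterG2 (two 1 4) = one 1 L.∷ two 1 4 L.∷ two 1 5 L.∷ two 1 6 L.∷ two 1 7 L.∷ []
afterG2 (two 1 5) = one 1 L.∷ two 1 5 L.∷ two 1 6 L.∷ two 1 7 L.∷ []
afterG2 (two 1 6) = one 1 L.∷ one 2 L.∷ two 1 6 L.∷ two 1 7 L.∷ two 2 6 L.∷ two 2 7 L.∷ []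
afterG2 (two 2 6) = one 2 L.∷ two 2 6 L.∷ two 2 7 L.∷ []
afterG2 (two 1 7) = one 1 L.∷ one 2 L.∷ one 3 L.∷ one 4 L.∷ two 1 7 L.∷ two 2 7 L.∷ two 3 7 L.∷ two 4 7 L.∷ []
afterG2 (two 2 7) = one 2 L.∷ one 3 L.∷ one 4 L.∷ two 2 7 L.∷ two 3 7 L.∷ two 4 7 L.∷ []
afterG2 (two 3 7) = one 3 L.∷ one 4 L.∷ two 3 7 L.∷ two 4 7 L.∷ []
afterG2 (two 4 7) = one 4 L.∷ two 4 7 L.∷ []
afterG2 _ = []

-- S_g(λ): the set of all tableau(t), t an order ideal of P^{βα}_g(a,b)

InS : (g : Lie) (a b : ℕ) → Tableau a b → Set
InS g a b T =
  Σ (Elem g a b → Bool) λ t →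
    IsIdeal t ×
    (∀ (i : Fin b) → col01 g (λ x → t (inj₁ (i , x))) ≡ just (dbl T i)) ×
    (∀ (j : Fin a) → col10 g (λ x → t (inj₂ (j , x))) ≡ sgl T j)

Described : (g : Lie) (a b : ℕ) → Tableau a b → Set
Described A2 a b T = Semistandard 3 T
Described C2 a b T =
  Semistandard 4 T ×
  (∀ k → column T k ≢ two 1 4) ×
  AtMostOnce T (two 2 3)
Described G2 a b T =
  Semistandard 7 T ×
  AtMostOnce T (one 4) ×
  (∀ k → column T k ∉ forbiddenG2) ×
  Consec T (λ c c' → c' ∉ afterG2 c)

module Submission where

-- An order ideal t of P amounts to an order ideal t_k of each copy Q_k of a
-- fundamental poset (one copy per column) such that any two copies Q_k, Q_k'
-- with k < k' are compatible: if y ∈ t_k' and x ∈ Q_k has the same chain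
-- index, then x ∈ t_k.  Writing decode c for the fundamental ideal assigned
-- the column c, everything reduces to finitely many columns:
--   * the fundamental ideals are exactly the decodings of the admissible
--     columns (those obeying the column-wise rules of the description);
--   * for admissible c, c' the local rule Follows c c' (weakly increasing
--     rows plus the pairwise rules of the description) holds iff decode c and
--     decode c' are compatible, and Follows is transitive.  Both sides
-- of the proposition are equivalent to T having a layout; for the description
-- transitivity reduces "any two columns" to "neighbouring columns".

open import Defs
open import Data.Nat using (ℕ; zero; suc; pred; _+_; _∸_; _≤_; _<_; _≤ᵇ_; z≤n; s≤s)
import Data.Nat.Properties as ℕ
open import Data.Fin using (Fin; toℕ; splitAt; _↑ˡ_; _↑ʳ_; fromℕ<)
import Data.Fin as F
import Data.Fin.Properties as FinP
open import Data.Vec using (Vec; []; _∷_; lookup; tabulate)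
import Data.Vec.Properties as VecP
open import Data.List using (List; []; _∷_; _++_; map; applyUpTo; cartesianProductWith; filter)
open import Data.List.Relation.Unary.All as All using (All)
open import Data.List.Relation.Unary.Any using (here; there)
open import Data.List.Membership.Propositional using (_∈_; _∉_)
open import Data.List.Membership.Propositional.Properties using (∈-filter⁺; ∈-filter⁻; ∈-++⁺ˡ; ∈-++⁺ʳ; ∈-map⁺; ∈-applyUpTo⁺; ∈-cartesianProductWith⁺)
import Data.List.Membership.DecPropositional as DecMembership
open import Data.Bool using (Bool; true; false; if_then_else_)
import Data.Bool.Properties as BoolP
open import Data.Maybe using (Maybe; just; nothing)
import Data.Maybe.Properties as MaybeP
open import Data.Product using (_×_; _,_; proj₁; proj₂)
import Data.Product.Properties as ProductP
open import Data.Sum using (inj₁; inj₂)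
open import Data.Unit using (⊤; tt)
open import Data.Empty using (⊥; ⊥-elim)
open import Function using (_∘_; id)
open import Function.Bundles using (_⇔_; mk⇔; Equivalence)
open import Relation.Binary.Definitions using (DecidableEquality; tri<; tri≈; tri>)
open import Relation.Binary.PropositionalEquality using (_≡_; _≢_; _≗_; refl; sym; trans; cong; cong₂; subst; subst₂)
open import Relation.Binary.Construct.Closure.ReflexiveTransitive using (Star; ε; _◅_; fold)
open import Relation.Nullary using (¬_; Dec; yes; no; map′; _×-dec_; _→-dec_; ¬?)
open import Relation.Nullary.Decidable using (from-yes)

_≟ᶜ_ : DecidableEquality Col
two i j ≟ᶜ two i' j' = map′ (λ (e , e') → cong₂ two e e') (λ { refl → refl , refl }) ((i ℕ.≟ i') ×-dec (j ℕ.≟ j'))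
one i ≟ᶜ one i' = map′ (cong one) (λ { refl → refl }) (i ℕ.≟ i')
two _ _ ≟ᶜ one _ = no λ ()
one _ ≟ᶜ two _ _ = no λ ()

open DecMembership _≟ᶜ_ using (_∈?_)

Increasing : Col → Set
Increasing (two i j) = i < j
Increasing (one _) = ⊤

ColumnRule : Lie → Col → Set
ColumnRule A2 c = ⊤
ColumnRule C2 c = c ≢ two 1 4
ColumnRule G2 c = c ∉ forbiddenG2

record Admissible (g : Lie) (c : Col) : Set where
  constructor admissible
  field
    inRange : InRange (bigN g) c
    increasing : Increasing c
    columnRule : ColumnRule g c
open Admissible

admissible? : ∀ g c → Dec (Admissible g c)
admissible? g c = map′ (λ (r , i , cr) → admissible r i cr) (λ a → inRange a , increasing a , columnRule a)
  (inRange? (bigN g) c ×-dec (increasing? c ×-dec columnRule? g c))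
  where
  inRange? : ∀ n c → Dec (InRange n c)
  inRange? n (two i j) = ((1 ℕ.≤? i) ×-dec (i ℕ.≤? n)) ×-dec ((1 ℕ.≤? j) ×-dec (j ℕ.≤? n))
  inRange? n (one i) = (1 ℕ.≤? i) ×-dec (i ℕ.≤? n)
  increasing? : ∀ c → Dec (Increasing c)
  increasing? (two i j) = i ℕ.<? j
  increasing? (one _) = yes tt
  columnRule? : ∀ g c → Dec (ColumnRule g c)
  columnRule? A2 c = yes tt
  columnRule? C2 c = ¬? (c ≟ᶜ two 1 4)
  columnRule? G2 c = ¬? (c ∈? forbiddenG2)

candidates : ℕ → List Col
candidates n = cartesianProductWith two entries entries ++ map one entries
  where
  entries : List ℕ
  entries = applyUpTo suc n

columns : Lie → List Col
columns g = filter (admissible? g) (candidates (bigN g))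

listed⇒admissible : ∀ {g c} → c ∈ columns g → Admissible g c
listed⇒admissible {g} = proj₂ ∘ ∈-filter⁻ (admissible? g) {xs = candidates (bigN g)}

admissible⇒listed : ∀ {g c} → Admissible g c → c ∈ columns g
admissible⇒listed {g} {c} adm = ∈-filter⁺ (admissible? g) (candidate (inRange adm)) adm
  where
  entry : ∀ {i n} → 1 ≤ i → i ≤ n → i ∈ applyUpTo suc n
  entry (s≤s z≤n) i≤n = ∈-applyUpTo⁺ suc i≤n
  candidate : ∀ {n c} → InRange n c → c ∈ candidates n
  candidate {n} {two i j} ((1≤i , i≤n) , (1≤j , j≤n)) = ∈-++⁺ˡ (∈-cartesianProductWith⁺ two (entry 1≤i i≤n) (entry 1≤j j≤n))
  candidate {n} {one i} (1≤i , i≤n) = ∈-++⁺ʳ _ (∈-map⁺ one (entry 1≤i i≤n))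

ShapeOK : Col → Col → Set
ShapeOK (one _) (two _ _) = ⊥
ShapeOK _ _ = ⊤

BottomsOK : Col → Col → Set
BottomsOK (two _ j) (two _ j') = j ≤ j'
BottomsOK _ _ = ⊤

PairRule : Lie → Col → Col → Set
PairRule A2 c c' = ⊤
PairRule C2 c c' = ¬ (c ≡ two 2 3 × c' ≡ two 2 3)
PairRule G2 c c' = ¬ (c ≡ one 4 × c' ≡ one 4) × c' ∉ afterG2 c

record Follows (g : Lie) (c c' : Col) : Set where
  constructor follows
  field
    shape : ShapeOK c c'
    tops : topEntry c ≤ topEntry c'
    bottoms : BottomsOK c c'
    pairRule : PairRule g c c'
open Follows

shape? : ∀ c c' → Dec (ShapeOK c c')
shape? (one _) (two _ _) = no λ ()
shape? (one _) (one _) = yes tt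
shape? (two _ _) _ = yes tt

follows? : ∀ g c c' → Dec (Follows g c c')
follows? g c c' = map′ (λ (s , t , b , r) → follows s t b r) (λ f → shape f , tops f , bottoms f , pairRule f)
  (shape? c c' ×-dec ((topEntry c ℕ.≤? topEntry c') ×-dec (bottoms? c c' ×-dec pairRule? g c c')))
  where
  bottoms? : ∀ c c' → Dec (BottomsOK c c')
  bottoms? (two _ j) (two _ j') = j ℕ.≤? j'
  bottoms? (two _ _) (one _) = yes tt
  bottoms? (one _) _ = yes tt
  pairRule? : ∀ g c c' → Dec (PairRule g c c')
  pairRule? A2 c c' = yes tt
  pairRule? C2 c c' = ¬? ((c ≟ᶜ two 2 3) ×-dec (c' ≟ᶜ two 2 3))
  pairRule? G2 c c' = ¬? ((c ≟ᶜ one 4) ×-dec (c' ≟ᶜ one 4)) ×-dec ¬? (c' ∈? afterG2 c)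

-- A length-two column lives on a copy of F(0,1), a length-one column on a
-- copy of F(1,0); size, chain index (as in P) and covering relation of the
-- copy are determined by the shape of the column.

size : Lie → Col → ℕ
size g (two _ _) = s01 g
size g (one _) = s10 g

chain : ∀ g c → Fin (size g c) → ℕ
chain g (two _ _) x = ci01 g x
chain g (one _) x = suc (ci10 g x)

Cover : ∀ g c → Fin (size g c) → Fin (size g c) → Set
Cover g (two _ _) = Cov01 g
Cover g (one _) = Cov10 g

-- the subset {x | m ≤ x} of indices, i.e. an ideal of a chain
from : ∀ {n} → ℕ → Fin n → Bool
from m x = m ≤ᵇ toℕ x

-- Membership vectors (a_1 , … , a_10) of the order ideals of the G2 poset
-- F(0,1), indexed by their columns (the last clause is the full ideal, (1,2)).
idealG2 : ℕ → ℕ → Vec Bool 10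
idealG2 6 7 = false ∷ false ∷ false ∷ false ∷ false ∷ false ∷ false ∷ false ∷ false ∷ false ∷ []
idealG2 5 7 = true ∷ false ∷ false ∷ false ∷ false ∷ false ∷ false ∷ false ∷ false ∷ false ∷ []
idealG2 4 7 = true ∷ true ∷ false ∷ false ∷ false ∷ false ∷ false ∷ false ∷ false ∷ false ∷ []
idealG2 3 7 = true ∷ true ∷ true ∷ false ∷ false ∷ false ∷ false ∷ false ∷ false ∷ false ∷ []
idealG2 2 7 = true ∷ true ∷ true ∷ true ∷ false ∷ false ∷ false ∷ false ∷ false ∷ false ∷ []
idealG2 3 6 = true ∷ true ∷ true ∷ false ∷ false ∷ true ∷ false ∷ false ∷ false ∷ false ∷ []
idealG2 2 6 = true ∷ true ∷ true ∷ true ∷ false ∷ true ∷ false ∷ false ∷ false ∷ false ∷ []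
idealG2 1 7 = true ∷ true ∷ true ∷ true ∷ true ∷ false ∷ false ∷ false ∷ false ∷ false ∷ []
idealG2 1 6 = true ∷ true ∷ true ∷ true ∷ true ∷ true ∷ false ∷ false ∷ false ∷ false ∷ []
idealG2 2 5 = true ∷ true ∷ true ∷ true ∷ false ∷ true ∷ true ∷ false ∷ false ∷ false ∷ []
idealG2 1 5 = true ∷ true ∷ true ∷ true ∷ true ∷ true ∷ true ∷ false ∷ false ∷ false ∷ []
idealG2 1 4 = true ∷ true ∷ true ∷ true ∷ true ∷ true ∷ true ∷ true ∷ false ∷ false ∷ []
idealG2 1 3 = true ∷ true ∷ true ∷ true ∷ true ∷ true ∷ true ∷ true ∷ true ∷ false ∷ []
idealG2 _ _ = true ∷ true ∷ true ∷ true ∷ true ∷ true ∷ true ∷ true ∷ true ∷ true ∷ []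

-- decode g c: the fundamental order ideal to which the column c is assigned
-- (for the chains F(1,0) and the A2, C2 posets F(0,1) an up-set of indices)
decode : ∀ g c → Fin (size g c) → Bool
decode A2 (two 2 3) = from 2
decode A2 (two 1 3) = from 1
decode A2 (two _ _) = from 0
decode C2 (two 3 4) = from 4
decode C2 (two 2 4) = from 3
decode C2 (two 2 3) = from 2
decode C2 (two 1 3) = from 1
decode C2 (two _ _) = from 0
decode G2 (two p q) = lookup (idealG2 p q)
decode g (one n) = from (pred n)

IsDownSet : ∀ {n} → (Fin n → Fin n → Set) → (Fin n → Bool) → Set
IsDownSet _⋖_ s = ∀ y → s y ≡ true → ∀ x → x ⋖ y → s x ≡ true

downSet-resp : ∀ {n} {_⋖_ : Fin n → Fin n → Set} {s s'} → s ≗ s' → IsDownSet _⋖_ s → IsDownSet _⋖_ s'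
downSet-resp s≗s' down y e x x⋖y = trans (sym (s≗s' x)) (down y (trans (s≗s' y) e) x x⋖y)

Compatible : ∀ g c c' → Set
Compatible g c c' = ∀ y → decode g c' y ≡ true → ∀ x → chain g c x ≡ chain g c' y → decode g c x ≡ true

compatible-resp : ∀ {g c c'} {s : Fin (size g c) → Bool} {s' : Fin (size g c') → Bool} →
  s ≗ decode g c → s' ≗ decode g c' →
  (∀ y → s' y ≡ true → ∀ x → chain g c x ≡ chain g c' y → s x ≡ true) → Compatible g c c'
compatible-resp s≗ s'≗ fits y e x ch = trans (sym (s≗ x)) (fits y (trans (s'≗ y) e) x ch)

Labels : ∀ g c → (Fin (size g c) → Bool) → Set
Labels g (two p q) s = col01 g s ≡ just (p , q)
Labels g (one n) s = col10 g s ≡ n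

countT-cong : ∀ n {s s' : Fin n → Bool} → s ≗ s' → countT n s ≡ countT n s'
countT-cong zero _ = refl
countT-cong (suc n) {s} {s'} s≗s' =
  cong₂ (λ b m → (if b then 1 else 0) + m) (s≗s' F.zero) (countT-cong n (s≗s' ∘ F.suc))

col01-cong : ∀ g {s s' : Fin (s01 g) → Bool} → s ≗ s' → col01 g s ≡ col01 g s'
col01-cong A2 s≗s' = cong colA2 (countT-cong 2 s≗s')
col01-cong C2 s≗s' = cong colC2 (countT-cong 4 s≗s')
col01-cong G2 s≗s' = cong colG2 (VecP.tabulate-cong s≗s')

col10-cong : ∀ g {s s' : Fin (s10 g) → Bool} → s ≗ s' → col10 g s ≡ col10 g s'
col10-cong g s≗s' = cong (bigN g ∸_) (countT-cong (s10 g) s≗s')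

coversG2 : List (ℕ × ℕ)
coversG2 = (0 , 1) ∷ (1 , 2) ∷ (2 , 3) ∷ (2 , 5) ∷ (3 , 4) ∷ (3 , 6) ∷ (5 , 6) ∷ (4 , 7) ∷ (6 , 7) ∷ (7 , 8) ∷ (8 , 9) ∷ []

covG2? : ∀ m n → Dec (CovG2 m n)
covG2? m n = map′ fromList toList ((m , n) ∈ℕ²? coversG2)
  where
  open DecMembership (ProductP.≡-dec ℕ._≟_ ℕ._≟_) using () renaming (_∈?_ to _∈ℕ²?_)
  toList : ∀ {m n} → CovG2 m n → (m , n) ∈ coversG2
  toList c1-2 = here refl
  toList c2-3 = there (here refl)
  toList c3-4 = there (there (here refl))
  toList c3-6 = there (there (there (here refl)))
  toList c4-5 = there (there (there (there (here refl))))
  toList c4-7 = there (there (there (there (there (here refl)))))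
  toList c6-7 = there (there (there (there (there (there (here refl))))))
  toList c5-8 = there (there (there (there (there (there (there (here refl)))))))
  toList c7-8 = there (there (there (there (there (there (there (there (here refl))))))))
  toList c8-9 = there (there (there (there (there (there (there (there (there (here refl)))))))))
  toList c9-10 = there (there (there (there (there (there (there (there (there (there (here refl))))))))))
  fromList : ∀ {m n} → (m , n) ∈ coversG2 → CovG2 m n
  fromList (here refl) = c1-2
  fromList (there (here refl)) = c2-3
  fromList (there (there (here refl))) = c3-4
  fromList (there (there (there (here refl)))) = c3-6
  fromList (there (there (there (there (here refl))))) = c4-5
  fromList (there (there (there (there (there (here refl)))))) = c4-7
  fromList (there (there (there (there (there (there (here refl))))))) = c6-7
  fromList (there (there (there (there (there (there (there (here refl)))))))) = c5-8
  fromList (there (there (there (there (there (there (there (there (here refl))))))))) = c7-8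
  fromList (there (there (there (there (there (there (there (there (there (here refl)))))))))) = c8-9
  fromList (there (there (there (there (there (there (there (there (there (there (here refl))))))))))) = c9-10

cover01? : ∀ g x y → Dec (Cov01 g x y)
cover01? A2 x y = toℕ x ℕ.≟ suc (toℕ y)
cover01? C2 x y = toℕ x ℕ.≟ suc (toℕ y)
cover01? G2 x y = covG2? (toℕ x) (toℕ y)

cover10? : ∀ g x y → Dec (Cov10 g x y)
cover10? g x y = toℕ x ℕ.≟ suc (toℕ y)

cover? : ∀ g c x y → Dec (Cover g c x y)
cover? g (two _ _) = cover01? g
cover? g (one _) = cover10? g

isDownSet? : ∀ {n} {_⋖_ : Fin n → Fin n → Set} → (∀ x y → Dec (x ⋖ y)) → ∀ s → Dec (IsDownSet _⋖_ s)
isDownSet? _⋖?_ s = FinP.all? λ y → (s y BoolP.≟ true) →-dec FinP.all? λ x → (x ⋖? y) →-dec (s x BoolP.≟ true)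

compatible? : ∀ g c c' → Dec (Compatible g c c')
compatible? g c c' = FinP.all? λ y → (decode g c' y BoolP.≟ true) →-dec FinP.all? λ x →
  (chain g c x ℕ.≟ chain g c' y) →-dec (decode g c x BoolP.≟ true)

labels? : ∀ g c s → Dec (Labels g c s)
labels? g (two p q) s = MaybeP.≡-dec (ProductP.≡-dec ℕ._≟_ ℕ._≟_) (col01 g s) (just (p , q))
labels? g (one n) s = col10 g s ℕ.≟ n

allVectors? : ∀ {n} {P : Vec Bool n → Set} → (∀ v → Dec (P v)) → Dec (∀ v → P v)
allVectors? {zero} P? = map′ (λ p → λ { [] → p }) (λ h → h []) (P? [])
allVectors? {suc n} P? = map′ (λ (t , f) → λ { (true ∷ v) → t v ; (false ∷ v) → f v })
  (λ h → (λ v → h (true ∷ v)) , (λ v → h (false ∷ v)))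
  (allVectors? (λ v → P? (true ∷ v)) ×-dec allVectors? (λ v → P? (false ∷ v)))

_⇔-dec_ : ∀ {A B : Set} → Dec A → Dec B → Dec (A ⇔ B)
a? ⇔-dec b? = map′ (λ (f , f⁻¹) → mk⇔ f f⁻¹) (λ e → Equivalence.to e , Equivalence.from e) ((a? →-dec b?) ×-dec (b? →-dec a?))

-- The finite verifications, each closed for every g by evaluating its
-- decision procedure (from-yes fails to typecheck unless the answer is yes).

DecodedAs01 : ∀ g → Vec Bool (s01 g) → Maybe (ℕ × ℕ) → Set
DecodedAs01 g v nothing = ⊥
DecodedAs01 g v (just (p , q)) = two p q ∈ columns g × lookup v ≗ decode g (two p q)

DecodedAs10 : ∀ g → Vec Bool (s10 g) → ℕ → Set
DecodedAs10 g v n = one n ∈ columns g × lookup v ≗ decode g (one n)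

FundamentalIdeals01 FundamentalIdeals10 DecodedColumns FollowsIsCompatible FollowsTransitive : Lie → Set
FundamentalIdeals01 g = ∀ v → IsDownSet (Cov01 g) (lookup v) → DecodedAs01 g v (col01 g (lookup v))
FundamentalIdeals10 g = ∀ v → IsDownSet (Cov10 g) (lookup v) → DecodedAs10 g v (col10 g (lookup v))
DecodedColumns g = All (λ c → IsDownSet (Cover g c) (decode g c) × Labels g c (decode g c)) (columns g)
FollowsIsCompatible g =
  All (λ c → All (λ c' → Follows g c c' ⇔ (ShapeOK c c' × Compatible g c c')) (columns g)) (columns g)
FollowsTransitive g =
  All (λ c → All (λ c' → Follows g c c' → All (λ c'' → Follows g c' c'' → Follows g c c'') (columns g)) (columns g)) (columns g)

fundamental-ideals01? : ∀ g → Dec (FundamentalIdeals01 g)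
fundamental-ideals01? g = allVectors? λ v → isDownSet? (cover01? g) (lookup v) →-dec decodedAs? v (col01 g (lookup v))
  where
  decodedAs? : ∀ v m → Dec (DecodedAs01 g v m)
  decodedAs? v nothing = no λ ()
  decodedAs? v (just (p , q)) = (two p q ∈? columns g) ×-dec FinP.all? (λ x → lookup v x BoolP.≟ decode g (two p q) x)

fundamental-ideals10? : ∀ g → Dec (FundamentalIdeals10 g)
fundamental-ideals10? g = allVectors? λ v → isDownSet? (cover10? g) (lookup v) →-dec decodedAs? v (col10 g (lookup v))
  where
  decodedAs? : ∀ v n → Dec (DecodedAs10 g v n)
  decodedAs? v n = (one n ∈? columns g) ×-dec FinP.all? (λ x → lookup v x BoolP.≟ decode g (one n) x)

decoded-columns? : ∀ g → Dec (DecodedColumns g)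
decoded-columns? g = All.all? (λ c → isDownSet? (cover? g c) (decode g c) ×-dec labels? g c (decode g c)) (columns g)

follows-is-compatible? : ∀ g → Dec (FollowsIsCompatible g)
follows-is-compatible? g = All.all? (λ c → All.all? (λ c' →
  follows? g c c' ⇔-dec (shape? c c' ×-dec compatible? g c c')) (columns g)) (columns g)

follows-transitive? : ∀ g → Dec (FollowsTransitive g)
follows-transitive? g = All.all? (λ c → All.all? (λ c' → follows? g c c' →-dec
  All.all? (λ c'' → follows? g c' c'' →-dec follows? g c c'') (columns g)) (columns g)) (columns g)

fundamental-ideals01 : ∀ g → FundamentalIdeals01 g
fundamental-ideals01 A2 = from-yes (fundamental-ideals01? A2)
fundamental-ideals01 C2 = from-yes (fundamental-ideals01? C2)
fundamental-ideals01 G2 = from-yes (fundamental-ideals01? G2)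

fundamental-ideals10 : ∀ g → FundamentalIdeals10 g
fundamental-ideals10 A2 = from-yes (fundamental-ideals10? A2)
fundamental-ideals10 C2 = from-yes (fundamental-ideals10? C2)
fundamental-ideals10 G2 = from-yes (fundamental-ideals10? G2)

decoded-columns : ∀ g → DecodedColumns g
decoded-columns A2 = from-yes (decoded-columns? A2)
decoded-columns C2 = from-yes (decoded-columns? C2)
decoded-columns G2 = from-yes (decoded-columns? G2)

follows-is-compatible : ∀ g → FollowsIsCompatible g
follows-is-compatible A2 = from-yes (follows-is-compatible? A2)
follows-is-compatible C2 = from-yes (follows-is-compatible? C2)
follows-is-compatible G2 = from-yes (follows-is-compatible? G2)

follows-transitive : ∀ g → FollowsTransitive g
follows-transitive A2 = from-yes (follows-transitive? A2)
follows-transitive C2 = from-yes (follows-transitive? C2)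
follows-transitive G2 = from-yes (follows-transitive? G2)

downSet01-decoded : ∀ g {s : Fin (s01 g) → Bool} {p q} → IsDownSet (Cov01 g) s → col01 g s ≡ just (p , q) →
  two p q ∈ columns g × s ≗ decode g (two p q)
downSet01-decoded g {s} down labelled =
  let (listed , decoded) = subst (DecodedAs01 g v) (trans (col01-cong g lookup≗s) labelled)
                             (fundamental-ideals01 g v (downSet-resp (sym ∘ lookup≗s) down))
  in listed , λ x → trans (sym (lookup≗s x)) (decoded x)
  where
  v : Vec Bool (s01 g)
  v = tabulate s
  lookup≗s : lookup v ≗ s
  lookup≗s = VecP.lookup∘tabulate s

downSet10-decoded : ∀ g {s : Fin (s10 g) → Bool} {n} → IsDownSet (Cov10 g) s → col10 g s ≡ n →
  one n ∈ columns g × s ≗ decode g (one n)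
downSet10-decoded g {s} down labelled =
  let (listed , decoded) = subst (DecodedAs10 g v) (trans (col10-cong g lookup≗s) labelled)
                             (fundamental-ideals10 g v (downSet-resp (sym ∘ lookup≗s) down))
  in listed , λ x → trans (sym (lookup≗s x)) (decoded x)
  where
  v : Vec Bool (s10 g)
  v = tabulate s
  lookup≗s : lookup v ≗ s
  lookup≗s = VecP.lookup∘tabulate s

decoded-downSet : ∀ {g c} → c ∈ columns g → IsDownSet (Cover g c) (decode g c)
decoded-downSet {g} c∈ = proj₁ (All.lookup (decoded-columns g) c∈)

decoded-labels : ∀ {g c} → c ∈ columns g → Labels g c (decode g c)
decoded-labels {g} c∈ = proj₂ (All.lookup (decoded-columns g) c∈)

follows⇔compatible : ∀ {g c c'} → c ∈ columns g → c' ∈ columns g → Follows g c c' ⇔ (ShapeOK c c' × Compatible g c c')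
follows⇔compatible {g} c∈ c'∈ = All.lookup (All.lookup (follows-is-compatible g) c∈) c'∈

fitting⇒follows : ∀ g {c c'} {s : Fin (size g c) → Bool} {s' : Fin (size g c') → Bool} →
  c ∈ columns g × s ≗ decode g c → c' ∈ columns g × s' ≗ decode g c' → ShapeOK c c' →
  (∀ y → s' y ≡ true → ∀ x → chain g c x ≡ chain g c' y → s x ≡ true) → Follows g c c'
fitting⇒follows g (c∈ , s≗) (c'∈ , s'≗) shapeOK fits =
  Equivalence.from (follows⇔compatible {g} c∈ c'∈) (shapeOK , compatible-resp {g} s≗ s'≗ fits)

follows-trans : ∀ {g c c' c''} → c ∈ columns g → c' ∈ columns g → c'' ∈ columns g →
  Follows g c c' → Follows g c' c'' → Follows g c c''
follows-trans {g} c∈ c'∈ c''∈ f f' = All.lookup (All.lookup (All.lookup (follows-transitive g) c∈) c'∈ f) c''∈ f'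

downward-closure : ∀ {A : Set} {R : A → A → Set} (t : A → Bool) →
  (∀ {x y} → R x y → t y ≡ true → t x ≡ true) → ∀ x y → Star R x y → t y ≡ true → t x ≡ true
downward-closure t step _ _ = fold (λ x y → t y ≡ true → t x ≡ true) (λ r below → step r ∘ below) id

neighbours⇒ordered : ∀ {A : Set} {n} {R : A → A → Set} (f : Fin n → A) →
  (∀ k k' k'' → R (f k) (f k') → R (f k') (f k'') → R (f k) (f k'')) →
  (∀ k k' → toℕ k' ≡ suc (toℕ k) → R (f k) (f k')) →
  ∀ k k' → toℕ k < toℕ k' → R (f k) (f k')
neighbours⇒ordered {n = n} {R} f R-trans R-next k k' k<k' =
  gap (toℕ k' ∸ suc (toℕ k)) k k' (trans (sym (ℕ.m∸n+n≡m k<k')) (ℕ.+-suc _ (toℕ k)))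
  where
  -- induction on the number d of terms strictly between k and k'
  gap : ∀ d k k' → toℕ k' ≡ suc (d + toℕ k) → R (f k) (f k')
  gap zero k k' next = R-next k k' next
  gap (suc d) k k' k'≡ = R-trans k m k' (gap d k m m≡) (R-next m k' (trans k'≡ (cong suc (sym m≡))))
    where
    m<n : suc (d + toℕ k) < n
    m<n = ℕ.<-trans (ℕ.≤-reflexive (sym k'≡)) (FinP.toℕ<n k')
    m : Fin n
    m = fromℕ< m<n
    m≡ : toℕ m ≡ suc (d + toℕ k)
    m≡ = FinP.toℕ-fromℕ< m<n

strict⇒weak : ∀ {n} {R : Fin n → Fin n → Set} → (∀ k → R k k) →
  (∀ k k' → toℕ k < toℕ k' → R k k') → ∀ k k' → toℕ k ≤ toℕ k' → R k k'
strict⇒weak R-refl R-strict k k' k≤k' with ℕ.m≤n⇒m<n∨m≡n k≤k'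
... | inj₁ k<k' = R-strict k k' k<k'
... | inj₂ k≡k' rewrite FinP.toℕ-injective k≡k' = R-refl k'

next⇒< : ∀ {m n} → n ≡ suc m → m < n
next⇒< n≡ = ℕ.≤-reflexive (sym n≡)

dcol : ∀ {a b} → Tableau a b → Fin b → Col
dcol T i = two (proj₁ (dbl T i)) (proj₂ (dbl T i))

scol : ∀ {a b} → Tableau a b → Fin a → Col
scol T j = one (sgl T j)

data ColumnIndex (a b : ℕ) : Fin (b + a) → Set where
  double : (i : Fin b) → ColumnIndex a b (i ↑ˡ a)
  single : (j : Fin a) → ColumnIndex a b (b ↑ʳ j)

columnIndex : ∀ {a b} (k : Fin (b + a)) → ColumnIndex a b k
columnIndex {a} {b} k with splitAt b k | FinP.join-splitAt b a k
... | inj₁ i | refl = double i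
... | inj₂ j | refl = single j

module _ {a b : ℕ} (T : Tableau a b) where

  column-double : ∀ i → column T (i ↑ˡ a) ≡ dcol T i
  column-double i rewrite FinP.splitAt-↑ˡ b i a = refl

  column-single : ∀ j → column T (b ↑ʳ j) ≡ scol T j
  column-single j rewrite FinP.splitAt-↑ʳ b a j = refl

  every-column : {P : Col → Set} → (∀ i → P (dcol T i)) → (∀ j → P (scol T j)) → ∀ k → P (column T k)
  every-column {P} Pd Ps k with columnIndex {a} {b} k
  ... | double i = subst P (sym (column-double i)) (Pd i)
  ... | single j = subst P (sym (column-single j)) (Ps j)

  at-double : {P : Col → Set} → (∀ k → P (column T k)) → ∀ i → P (dcol T i)
  at-double {P} P-all i = subst P (column-double i) (P-all (i ↑ˡ a))

  at-single : {P : Col → Set} → (∀ k → P (column T k)) → ∀ j → P (scol T j)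
  at-single {P} P-all j = subst P (column-single j) (P-all (b ↑ʳ j))

  ordered-columns : {P : Col → Col → Set} →
    (∀ {i i'} → toℕ i < toℕ i' → P (dcol T i) (dcol T i')) → (∀ i j → P (dcol T i) (scol T j)) →
    (∀ {j j'} → toℕ j < toℕ j' → P (scol T j) (scol T j')) →
    ∀ k k' → toℕ k < toℕ k' → P (column T k) (column T k')
  ordered-columns {P} Pdd Pds Pss k k' k<k' with columnIndex {a} {b} k | columnIndex {a} {b} k'
  ... | double i | double i' = subst₂ P (sym (column-double i)) (sym (column-double i'))
                                 (Pdd (subst₂ _<_ (FinP.toℕ-↑ˡ i a) (FinP.toℕ-↑ˡ i' a) k<k'))
  ... | double i | single j' = subst₂ P (sym (column-double i)) (sym (column-single j')) (Pds i j')
  ... | single j | single j' = subst₂ P (sym (column-single j)) (sym (column-single j'))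
                                 (Pss (ℕ.+-cancelˡ-< b _ _ (subst₂ _<_ (FinP.toℕ-↑ʳ b j) (FinP.toℕ-↑ʳ b j') k<k')))
  ... | single j | double i' = ⊥-elim (ℕ.m+n≮m b (toℕ j)
          (ℕ.<-trans (subst₂ _<_ (FinP.toℕ-↑ʳ b j) (FinP.toℕ-↑ˡ i' a) k<k') (FinP.toℕ<n i')))

  module _ {P : Col → Col → Set} (P-ordered : ∀ k k' → toℕ k < toℕ k' → P (column T k) (column T k')) where

    double-pair : ∀ {i i'} → toℕ i < toℕ i' → P (dcol T i) (dcol T i')
    double-pair {i} {i'} i<i' = subst₂ P (column-double i) (column-double i')
      (P-ordered (i ↑ˡ a) (i' ↑ˡ a) (subst₂ _<_ (sym (FinP.toℕ-↑ˡ i a)) (sym (FinP.toℕ-↑ˡ i' a)) i<i'))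

    double-single : ∀ i j → P (dcol T i) (scol T j)
    double-single i j = subst₂ P (column-double i) (column-single j)
      (P-ordered (i ↑ˡ a) (b ↑ʳ j) (subst₂ _<_ (sym (FinP.toℕ-↑ˡ i a)) (sym (FinP.toℕ-↑ʳ b j))
        (ℕ.<-≤-trans (FinP.toℕ<n i) (ℕ.m≤m+n b (toℕ j)))))

    single-pair : ∀ {j j'} → toℕ j < toℕ j' → P (scol T j) (scol T j')
    single-pair {j} {j'} j<j' = subst₂ P (column-single j) (column-single j')
      (P-ordered (b ↑ʳ j) (b ↑ʳ j') (subst₂ _<_ (sym (FinP.toℕ-↑ʳ b j)) (sym (FinP.toℕ-↑ʳ b j')) (ℕ.+-monoʳ-< b j<j')))

  never-twice⇒at-most-once : ∀ {c} → (∀ k k' → toℕ k < toℕ k' → ¬ (column T k ≡ c × column T k' ≡ c)) → AtMostOnce T c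
  never-twice⇒at-most-once never k k' k≡c k'≡c with ℕ.<-cmp (toℕ k) (toℕ k')
  ... | tri< k<k' _ _ = ⊥-elim (never k k' k<k' (k≡c , k'≡c))
  ... | tri≈ _ k≡k' _ = FinP.toℕ-injective k≡k'
  ... | tri> _ _ k'<k = ⊥-elim (never k' k k'<k (k'≡c , k≡c))

  at-most-once⇒not-next : ∀ {c} → AtMostOnce T c → ∀ k k' → toℕ k' ≡ suc (toℕ k) → ¬ (column T k ≡ c × column T k' ≡ c)
  at-most-once⇒not-next once k k' next (k≡c , k'≡c) = ℕ.<-irrefl (cong toℕ (once k k' k≡c k'≡c)) (next⇒< next)

record Layout (g : Lie) (a b : ℕ) (T : Tableau a b) : Set where
  constructor layout
  field
    listed : ∀ k → column T k ∈ columns g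
    ordered : ∀ k k' → toℕ k < toℕ k' → Follows g (column T k) (column T k')

-- If T = tableau(t) then the ideals t ∩ Q_k are the decodings of the
-- columns of T; the order of P makes these pairwise compatible.
ideal⇒layout : ∀ {g a b} (T : Tableau a b) → InS g a b T → Layout g a b T
ideal⇒layout {g} {a} {b} T (t , ideal , labelledD , labelledS) =
  layout (every-column T {_∈ columns g} (proj₁ ∘ double-decoded) (proj₁ ∘ single-decoded))
         (ordered-columns T {Follows g} follows-dd follows-ds follows-ss)
  where
  below : ∀ {x y} → Gen g a b x y → t y ≡ true → t x ≡ true
  below x<y = ideal _ _ (x<y ◅ ε)

  double-decoded : ∀ i → dcol T i ∈ columns g × (λ x → t (inj₁ (i , x))) ≗ decode g (dcol T i)
  double-decoded i = downSet01-decoded g (λ y e x x⋖y → below (in01 x⋖y) e) (labelledD i)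

  single-decoded : ∀ j → scol T j ∈ columns g × (λ x → t (inj₂ (j , x))) ≗ decode g (scol T j)
  single-decoded j = downSet10-decoded g (λ y e x x⋖y → below (in10 x⋖y) e) (labelledS j)

  follows-dd : ∀ {i i'} → toℕ i < toℕ i' → Follows g (dcol T i) (dcol T i')
  follows-dd i<i' = fitting⇒follows g (double-decoded _) (double-decoded _) tt λ y e x same → below (x0101 i<i' same) e

  follows-ds : ∀ i j → Follows g (dcol T i) (scol T j)
  follows-ds i j = fitting⇒follows g (double-decoded i) (single-decoded j) tt λ y e x same → below (x0110 same) e

  follows-ss : ∀ {j j'} → toℕ j < toℕ j' → Follows g (scol T j) (scol T j')
  follows-ss j<j' = fitting⇒follows g (single-decoded _) (single-decoded _) tt λ y e x same → below (x1010 j<j' same) e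

decodeTableau : ∀ g {a b} → Tableau a b → Elem g a b → Bool
decodeTableau g T (inj₁ (i , x)) = decode g (dcol T i) x
decodeTableau g T (inj₂ (j , x)) = decode g (scol T j) x

-- Conversely, decoding the columns of a layout gives an order ideal of P:
-- each generating relation of P is respected, by the verified facts.
layout⇒ideal : ∀ {g a b} (T : Tableau a b) → Layout g a b T → InS g a b T
layout⇒ideal {g} {a} {b} T (layout listed ordered) =
  t , downward-closure t respects , (decoded-labels {g} ∘ double-listed) , (decoded-labels {g} ∘ single-listed)
  where
  t : Elem g a b → Bool
  t = decodeTableau g T

  double-listed : ∀ i → dcol T i ∈ columns g
  double-listed = at-double T {_∈ columns g} listed

  single-listed : ∀ j → scol T j ∈ columns g
  single-listed = at-single T {_∈ columns g} listed

  compatible : ∀ k k' → toℕ k < toℕ k' → Compatible g (column T k) (column T k')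
  compatible k k' k<k' = proj₂ (Equivalence.to (follows⇔compatible (listed k) (listed k')) (ordered k k' k<k'))

  respects : ∀ {x y} → Gen g a b x y → t y ≡ true → t x ≡ true
  respects (in01 {i} {x} {y} x⋖y) e = decoded-downSet {g} (double-listed i) y e x x⋖y
  respects (in10 {j} {x} {y} x⋖y) e = decoded-downSet {g} (single-listed j) y e x x⋖y
  respects (x0101 {x = x} {y} i<i' same) e = double-pair T {Compatible g} compatible i<i' y e x same
  respects (x1010 {x = x} {y} j<j' same) e = single-pair T {Compatible g} compatible j<j' y e x same
  respects (x0110 {i} {j} {x} {y} same) e = double-single T {Compatible g} compatible i j y e x same

described-parts : ∀ g {a b} (T : Tableau a b) → Described g a b T →
  Semistandard (bigN g) T × (∀ k → ColumnRule g (column T k)) ×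
  (∀ k k' → toℕ k' ≡ suc (toℕ k) → PairRule g (column T k) (column T k'))
described-parts A2 T ss = ss , (λ _ → tt) , (λ _ _ _ → tt)
described-parts C2 T (ss , no14 , once23) = ss , no14 , at-most-once⇒not-next T once23
described-parts G2 T (ss , once4 , allowed , consecutive) =
  ss , allowed , λ k k' next → at-most-once⇒not-next T once4 k k' next , consecutive k k' next

describe : ∀ g {a b} (T : Tableau a b) → Semistandard (bigN g) T → (∀ k → ColumnRule g (column T k)) →
  (∀ k k' → toℕ k < toℕ k' → PairRule g (column T k) (column T k')) → Described g a b T
describe A2 T ss _ _ = ss
describe C2 T ss rule pair = ss , rule , never-twice⇒at-most-once T pair
describe G2 T ss rule pair =
  ss , never-twice⇒at-most-once T (λ k k' → proj₁ ∘ pair k k') , rule , λ k k' → proj₂ ∘ pair k k' ∘ next⇒<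

layout⇒described : ∀ {g a b} (T : Tableau a b) → Layout g a b T → Described g a b T
layout⇒described {g} T (layout listed ordered) =
  describe g T semistandard (columnRule ∘ admissible-at) (λ k k' → pairRule ∘ ordered k k')
  where
  admissible-at : ∀ k → Admissible g (column T k)
  admissible-at k = listed⇒admissible (listed k)

  semistandard : Semistandard (bigN g) T
  semistandard =
    inRange ∘ admissible-at ,
    at-double T {Increasing} (increasing ∘ admissible-at) ,
    strict⇒weak {R = λ k k' → topEntry (column T k) ≤ topEntry (column T k')} (λ _ → ℕ.≤-refl)
      (λ k k' → tops ∘ ordered k k') ,
    strict⇒weak {R = λ i i' → proj₂ (dbl T i) ≤ proj₂ (dbl T i')} (λ _ → ℕ.≤-refl)
      (λ i i' → double-pair T {BottomsOK} (λ k k' → bottoms ∘ ordered k k'))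

-- A described tableau has admissible columns with the local rule between
-- neighbours, hence, by transitivity, between any two columns.
described⇒layout : ∀ {g a b} (T : Tableau a b) → Described g a b T → Layout g a b T
described⇒layout {g} T d with described-parts g T d
... | (inRanges , strict , rows , bottomRows) , rule , nextRule =
  layout listed (neighbours⇒ordered {R = Follows g} (column T) transitive next)
  where
  listed : ∀ k → column T k ∈ columns g
  listed k = admissible⇒listed (admissible (inRanges k) (every-column T {Increasing} strict (λ _ → tt) k) (rule k))

  next : ∀ k k' → toℕ k' ≡ suc (toℕ k) → Follows g (column T k) (column T k')
  next k k' k'≡ = follows
    (ordered-columns T {ShapeOK} (λ _ → tt) (λ _ _ → tt) (λ _ → tt) k k' k<k')
    (rows k k' (ℕ.<⇒≤ k<k'))
    (ordered-columns T {BottomsOK} (λ {i} {i'} → bottomRows i i' ∘ ℕ.<⇒≤) (λ _ _ → tt) (λ _ → tt) k k' k<k')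
    (nextRule k k' k'≡)
    where
    k<k' : toℕ k < toℕ k'
    k<k' = next⇒< k'≡

  transitive : ∀ k k' k'' → Follows g (column T k) (column T k') → Follows g (column T k') (column T k'') →
    Follows g (column T k) (column T k'')
  transitive k k' k'' = follows-trans (listed k) (listed k') (listed k'')

proposition4p5 : ∀ (g : Lie) (a b : ℕ) (T : Tableau a b) → InS g a b T ⇔ Described g a b T
proposition4p5 g a b T = mk⇔ (layout⇒described T ∘ ideal⇒layout T) (layout⇒ideal T ∘ described⇒layout T)
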